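{- If $\Phi$ is a round representation such that $\mathcal{G}(\Phi)$ is co-bipartite, then the family of co-contig pairs of $\Phi$ admits a natural ordering.
   Context: An ordered semiblock family is a sequence $\mathcal{B}=B_1,\dots,B_k$ of pairwise disjoint nonempty sets (semiblocks); indices are taken modulo $k$. For $X=B_i$, $Y=B_j$, the range $[X,Y]$ is $B_i,B_{i+1},\dots,B_j$ (indices modulo $k$). A round representation is a pair $\Phi=(\mathcal{B},F_r)$ with $F_r:\mathcal{B}\to\mathcal{B}$ such that $F_r(B_i)\in[B_i,F_r(B_{i+1})]$ for every $i$; write $B\to W$ when $W\in(B,F_r(B)]$ (the range $[B,F_r(B)]$ without its first element). Round representations are assumed normal: for every pair $B,W$, not both $B\to W$ and $W\to B$. The round graph $\mathcal{G}(\Phi)$ has vertex set $\mathcal{B}$, with $B,W$ adjacent iff $B\to W$ or $W\to B$. A co-component of a graph is the subgraph induced by a component of its complement; a co-bipartition of a co-component is a partition of its vertices into two cliques (one possibly empty). A co-contig pair of $\Phi$ is a pair $(\mathcal{X},\mathcal{Y})$ of (possibly empty) ranges of $\mathcal{B}$ that is a co-bipartition of some co-component of $\mathcal{G}(\Phi)$. An ordering $(\mathcal{X}_1,\mathcal{Y}_1),\dots,(\mathcal{X}_s,\mathcal{Y}_s)$ of all co-contig pairs of $\Phi$ is natural if $\mathcal{B}$ equals the concatenation $\mathcal{X}_1\cdots\mathcal{X}_s\,\mathcal{Y}_1\cdots\mathcal{Y}_s$. -}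

module Defs where

open import Data.Nat using (ℕ; zero; suc; _+_; _∸_; _≤_; _<_)
open import Data.Nat.Properties using (_<?_; _≤?_)
open import Data.Fin using (Fin; toℕ; fromℕ<)
open import Data.List using (List; []; _∷_; _++_; concat; map; take; drop; allFin)
open import Data.List.Membership.Propositional using (_∈_)
open import Data.List.Relation.Unary.All using (All)
open import Data.Product using (_×_; _,_; proj₁; proj₂; ∃; Σ)
open import Data.Sum using (_⊎_)
open import Data.Bool using (Bool)
open import Relation.Nullary using (¬_; yes; no)
open import Relation.Binary.PropositionalEquality using (_≡_; _≢_)

-- The semiblock family B_1,…,B_k is modelled by its index set Fin k
-- (only the cyclic order of the semiblocks matters for every notion below).

next : ∀ {k} → Fin k → Fin k
next {suc n} i with suc (toℕ i) <? suc n
... | yes p = fromℕ< p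
... | no _  = Fin.zero

off : ∀ {k} → Fin k → Fin k → ℕ
off {k} i w with toℕ i ≤? toℕ w
... | yes _ = toℕ w ∸ toℕ i
... | no _  = (k + toℕ w) ∸ toℕ i

InRange : ∀ {k} → Fin k → Fin k → Fin k → Set
InRange x y w = off x w ≤ off x y

seg : ∀ {k} → Fin k → ℕ → List (Fin k)
seg i zero    = []
seg i (suc L) = i ∷ seg (next i) L

range : ∀ {k} → Fin k → Fin k → List (Fin k)
range x y = seg x (suc (off x y))

IsRange : ∀ {k} → List (Fin k) → Set
IsRange {k} xs = xs ≡ [] ⊎ ∃ λ (x : Fin k) → ∃ λ (y : Fin k) → xs ≡ range x y

-- a round representation Φ = (ℬ, F_r) on the family indexed by Fin k
IsRoundRep : ∀ {k} → (Fin k → Fin k) → Set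
IsRoundRep {k} F = (i : Fin k) → InRange i (F (next i)) (F i)

Arrow : ∀ {k} → (Fin k → Fin k) → Fin k → Fin k → Set
Arrow F b w = (0 < off b w) × (off b w ≤ off b (F b))

IsNormal : ∀ {k} → (Fin k → Fin k) → Set
IsNormal {k} F = (b w : Fin k) → ¬ (Arrow F b w × Arrow F w b)

Adj : ∀ {k} → (Fin k → Fin k) → Fin k → Fin k → Set
Adj F b w = Arrow F b w ⊎ Arrow F w b

CoBipartite : ∀ {k} → (Fin k → Fin k) → Set
CoBipartite {k} F = Σ (Fin k → Bool) λ c →
  (a b : Fin k) → c a ≡ c b → a ≢ b → Adj F a b

data CoReach {k} (F : Fin k → Fin k) (v : Fin k) : Fin k → Set where
  here : CoReach F v v
  step : ∀ {u w} → CoReach F v u → u ≢ w → ¬ Adj F u w → CoReach F v w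

IsClique : ∀ {k} → (Fin k → Fin k) → List (Fin k) → Set
IsClique F xs = ∀ {a b} → a ∈ xs → b ∈ xs → a ≢ b → Adj F a b

IsCoBipartitionOf : ∀ {k} → (Fin k → Fin k) → Fin k → List (Fin k) → List (Fin k) → Set
IsCoBipartitionOf {k} F v X Y =
  ((w : Fin k) → (w ∈ X ⊎ w ∈ Y) → CoReach F v w)
  × ((w : Fin k) → CoReach F v w → w ∈ X ⊎ w ∈ Y)
  × ((w : Fin k) → w ∈ X → ¬ (w ∈ Y))
  × IsClique F X × IsClique F Y

IsCoContigPair : ∀ {k} → (Fin k → Fin k) → List (Fin k) × List (Fin k) → Set
IsCoContigPair {k} F (X , Y) =
  IsRange X × IsRange Y × ∃ λ (v : Fin k) → IsCoBipartitionOf F v X Y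

Rotation : ∀ {k} → List (Fin k) → Set
Rotation {k} xs = ∃ λ (m : ℕ) → xs ≡ drop m (allFin k) ++ take m (allFin k)

NaturalOrdering : ∀ {k} → (Fin k → Fin k) → List (List (Fin k) × List (Fin k)) → Set
NaturalOrdering {k} F ps =
  All (IsCoContigPair F) ps
  × ((X Y : List (Fin k)) → IsCoContigPair F (X , Y) → (X , Y) ∈ ps ⊎ (Y , X) ∈ ps)
  × Rotation (concat (map proj₁ ps) ++ concat (map proj₂ ps))

-- Some semiblock z splits ℬ into two consecutive cliques [z, F z] and the rest: otherwise, going once
-- around the circle, each semiblock and its successor would both miss the first semiblock beyond the
-- successor's arc, hence share their colour in the co-bipartition, and a non-edge could not exist (if
-- 𝒢(Φ) is complete, any base point works). Read from z, the endpoints of the arcs never move backwards,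
-- so the co-edges between the two cliques form a staircase. Consequently each co-component consists of
-- a range of the first clique and a range of the second, these ranges appear in the same order on both
-- sides, and a sweep through both cliques lists them in a natural ordering. Since a co-bipartition into
-- ranges is unique up to swapping, every co-contig pair is listed.

module Submission where

open import Defs
open import Data.Nat using (ℕ; zero; suc; _+_; _∸_; _≤_; _<_; z≤n; s≤s; s≤s⁻¹)
open import Data.Nat.Properties
open import Data.Nat.Tactic.RingSolver using (solve)
open import Data.Bool using (Bool)
open import Data.Bool.Properties using (¬-not)
open import Data.Fin using (Fin; toℕ; fromℕ<)
import Data.Fin as Fin
open import Data.Fin.Properties using (toℕ<n; toℕ-injective; fromℕ<-toℕ; toℕ-fromℕ<; any?)
open import Data.List using (List; []; _∷_; _++_; concat; map; take; drop; allFin; tabulate)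
open import Data.List.Properties using (take-all; length-drop; length-tabulate; take++drop≡id)
open import Data.List.Relation.Unary.All using (All; lookup)
import Data.List.Relation.Unary.All as All
open import Data.List.Relation.Unary.Any using (here; there)
open import Data.List.Relation.Binary.Subset.Propositional using (_⊆_)
open import Data.List.Membership.Propositional using (_∈_)
open import Data.List.Membership.Propositional.Properties
  using (∈-allFin; ∈-++⁻; ∈-++⁺ˡ; ∈-++⁺ʳ; ∈-concat⁻′; ∈-map⁻)
open import Data.Product using (_×_; _,_; proj₁; proj₂; Σ; ∃) renaming (swap to ×-swap)
open import Data.Sum using (_⊎_; inj₁; inj₂; swap; [_,_]′)
open import Data.Empty using (⊥-elim)
open import Function using (_∘_; id)
open import Relation.Nullary using (¬_; yes; no; Dec; Irrelevant)
open import Relation.Nullary.Decidable using (map′; _×-dec_; _⊎-dec_; ¬?)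
open import Relation.Binary.Definitions using (tri<; tri≈; tri>)
open import Relation.Binary.PropositionalEquality

toℕ-next : ∀ {k} (i : Fin k) →
  (suc (toℕ i) < k × toℕ (next i) ≡ suc (toℕ i)) ⊎ (suc (toℕ i) ≡ k × toℕ (next i) ≡ 0)
toℕ-next {k = suc n} i with suc (toℕ i) <? suc n
... | yes i+1<k = inj₁ (i+1<k , toℕ-fromℕ< i+1<k)
... | no i+1≮k  = inj₂ (≤-antisym (toℕ<n i) (≮⇒≥ i+1≮k) , refl)

drop-tabulate : ∀ {A : Set} {k} m (m<k : m < k) (f : Fin k → A) →
  drop m (tabulate f) ≡ f (fromℕ< m<k) ∷ drop (suc m) (tabulate f)
drop-tabulate {k = suc k} zero    _         f = refl
drop-tabulate {k = suc k} (suc m) (s≤s m<k) f = drop-tabulate m m<k (f ∘ Fin.suc)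

module _ {k : ℕ} where

  off-cases : (a b : Fin k) →
    (toℕ a ≤ toℕ b × off a b + toℕ a ≡ toℕ b) ⊎ (toℕ b < toℕ a × off a b + toℕ a ≡ k + toℕ b)
  off-cases a b with toℕ a ≤? toℕ b
  ... | yes a≤b = inj₁ (a≤b , m∸n+n≡m a≤b)
  ... | no a≰b  = inj₂ (≰⇒> a≰b , m∸n+n≡m (≤-trans (<⇒≤ (toℕ<n a)) (m≤m+n k (toℕ b))))

  off< : (a b : Fin k) → off a b < k
  off< a b with off-cases a b
  ... | inj₁ (_ , e)  = ≤-<-trans (m≤m+n (off a b) (toℕ a)) (subst (_< k) (sym e) (toℕ<n b))
  ... | inj₂ (b<a , e) =
    +-cancelʳ-< (toℕ a) (off a b) k (subst (_< k + toℕ a) (sym e) (+-monoʳ-< k b<a))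

  off-refl : (a : Fin k) → off a a ≡ 0
  off-refl a with off-cases a a
  ... | inj₁ (_ , e)  = +-cancelʳ-≡ (toℕ a) _ 0 e
  ... | inj₂ (a<a , _) = ⊥-elim (<-irrefl refl a<a)

  off≡0⇒≡ : (a b : Fin k) → off a b ≡ 0 → a ≡ b
  off≡0⇒≡ a b o≡0 with off-cases a b
  ... | inj₁ (_ , e)  = toℕ-injective (trans (cong (_+ toℕ a) (sym o≡0)) e)
  ... | inj₂ (_ , e) = ⊥-elim (<⇒≱ (toℕ<n a) (begin
    k                  ≤⟨ m≤m+n k (toℕ b) ⟩
    k + toℕ b          ≡⟨ sym e ⟩
    off a b + toℕ a    ≡⟨ cong (_+ toℕ a) o≡0 ⟩
    toℕ a              ∎))
    where open ≤-Reasoning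

  off>0 : (a b : Fin k) → a ≢ b → 0 < off a b
  off>0 a b a≢b = n≢0⇒n>0 (a≢b ∘ off≡0⇒≡ a b)

  off-triangle : (a b c : Fin k) →
    off a b + off b c ≡ off a c ⊎ off a b + off b c ≡ off a c + k
  off-triangle a b c = combine (wrap a b) (wrap b c) (wrap a c)
    where
    -- p ∈ {0, k} records whether the step from x to y passes the last index of Fin k.
    Wrap : Fin k → Fin k → ℕ → Set
    Wrap x y p = ((p ≡ 0 × toℕ x ≤ toℕ y) ⊎ (p ≡ k × toℕ y < toℕ x)) × off x y + toℕ x ≡ p + toℕ y

    wrap : ∀ x y → Σ ℕ (Wrap x y)
    wrap x y with off-cases x y
    ... | inj₁ (x≤y , e) = 0 , inj₁ (refl , x≤y) , e
    ... | inj₂ (y<x , e) = k , inj₂ (refl , y<x) , e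

    sum-wraps : ∀ x y z p q r A B C →
      x + A ≡ p + B → y + B ≡ q + C → z + A ≡ r + C → (x + y) + r ≡ z + (p + q)
    sum-wraps x y z p q r A B C e₁ e₂ e₃ = +-cancelʳ-≡ A _ _ (begin
      x + y + r + A     ≡⟨ solve (x ∷ y ∷ r ∷ A ∷ []) ⟩
      y + r + (x + A)   ≡⟨ cong (y + r +_) e₁ ⟩
      y + r + (p + B)   ≡⟨ solve (y ∷ r ∷ p ∷ B ∷ []) ⟩
      p + r + (y + B)   ≡⟨ cong (p + r +_) e₂ ⟩
      p + r + (q + C)   ≡⟨ solve (p ∷ r ∷ q ∷ C ∷ []) ⟩
      p + q + (r + C)   ≡⟨ cong (p + q +_) (sym e₃) ⟩
      p + q + (z + A)   ≡⟨ solve (p ∷ q ∷ z ∷ A ∷ []) ⟩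
      z + (p + q) + A   ∎)
      where open ≡-Reasoning

    combine : Σ ℕ (Wrap a b) → Σ ℕ (Wrap b c) → Σ ℕ (Wrap a c) →
      off a b + off b c ≡ off a c ⊎ off a b + off b c ≡ off a c + k
    combine (p , wp , e₁) (q , wq , e₂) (r , wr , e₃) = go wp wq wr (sum-wraps _ _ _ p q r _ _ _ e₁ e₂ e₃)
      where
      x = off a b
      y = off b c
      z = off a c
      go : (p ≡ 0 × toℕ a ≤ toℕ b) ⊎ (p ≡ k × toℕ b < toℕ a) →
           (q ≡ 0 × toℕ b ≤ toℕ c) ⊎ (q ≡ k × toℕ c < toℕ b) →
           (r ≡ 0 × toℕ a ≤ toℕ c) ⊎ (r ≡ k × toℕ c < toℕ a) →
           x + y + r ≡ z + (p + q) → x + y ≡ z ⊎ x + y ≡ z + k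
      go (inj₁ (refl , _)) (inj₁ (refl , _)) (inj₁ (refl , _)) e =
        inj₁ (trans (sym (+-identityʳ _)) (trans e (+-identityʳ z)))
      go (inj₁ (refl , l₁)) (inj₁ (refl , l₂)) (inj₂ (refl , l₃)) e = ⊥-elim (<⇒≱ l₃ (≤-trans l₁ l₂))
      go (inj₂ (refl , _)) (inj₁ (refl , _)) (inj₁ (refl , _)) e =
        inj₂ (trans (sym (+-identityʳ _)) (trans e (cong (z +_) (+-identityʳ k))))
      go (inj₂ (refl , _)) (inj₁ (refl , _)) (inj₂ (refl , _)) e =
        inj₁ (+-cancelʳ-≡ k _ _ (trans e (cong (z +_) (+-identityʳ k))))
      go (inj₁ (refl , _)) (inj₂ (refl , _)) (inj₁ (refl , _)) e = inj₂ (trans (sym (+-identityʳ _)) e)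
      go (inj₁ (refl , _)) (inj₂ (refl , _)) (inj₂ (refl , _)) e = inj₁ (+-cancelʳ-≡ k _ _ e)
      go (inj₂ (refl , l₁)) (inj₂ (refl , l₂)) (inj₁ (refl , l₃)) e = ⊥-elim (<⇒≱ (<-trans l₂ l₁) l₃)
      go (inj₂ (refl , _)) (inj₂ (refl , _)) (inj₂ (refl , _)) e =
        inj₂ (+-cancelʳ-≡ k _ _ (trans e (sym (+-assoc z k k))))

  off-triangle-≤ : (a b c : Fin k) → off a c ≤ off a b + off b c
  off-triangle-≤ a b c with off-triangle a b c
  ... | inj₁ e = ≤-reflexive (sym e)
  ... | inj₂ e = subst (off a c ≤_) (sym e) (m≤m+n _ _)

  off-next : (i : Fin k) → 1 < k → off i (next i) ≡ 1
  off-next i 1<k with toℕ-next i | off-cases i (next i)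
  ... | inj₁ (_ , e) | inj₁ (_ , e′) = +-cancelʳ-≡ (toℕ i) _ 1 (trans e′ e)
  ... | inj₁ (_ , e) | inj₂ (i+1<i , _) = ⊥-elim (<-asym i+1<i (subst (toℕ i <_) (sym e) (n<1+n _)))
  ... | inj₂ (i+1≡k , e) | inj₁ (i≤i+1 , _) =
    ⊥-elim (<⇒≱ 1<k (subst (_≤ 1) i+1≡k (s≤s (subst (toℕ i ≤_) e i≤i+1))))
  ... | inj₂ (i+1≡k , e) | inj₂ (_ , e′) =
    +-cancelʳ-≡ (toℕ i) _ 1 (trans e′ (trans (cong (k +_) e) (trans (+-identityʳ k) (sym i+1≡k))))

  off-next≤1 : (i : Fin k) → off i (next i) ≤ 1
  off-next≤1 i with 1 <? k
  ... | yes 1<k = ≤-reflexive (off-next i 1<k)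
  ... | no 1≮k  = ≤-trans (<⇒≤ (off< i (next i))) (≮⇒≥ 1≮k)

  next^ : ℕ → Fin k → Fin k
  next^ zero    x = x
  next^ (suc n) x = next^ n (next x)

  next^-+ : ∀ m n (x : Fin k) → next^ (m + n) x ≡ next^ n (next^ m x)
  next^-+ zero    n x = refl
  next^-+ (suc m) n x = next^-+ m n (next x)

  next^-suc : ∀ t (x : Fin k) → next^ (suc t) x ≡ next (next^ t x)
  next^-suc t x = trans (cong (λ s → next^ s x) (+-comm 1 t)) (next^-+ t 1 x)

  off-next^ : ∀ t (x : Fin k) → t < k → off x (next^ t x) ≡ t
  off-next^ zero    x _   = off-refl x
  off-next^ (suc t) x t<k
    with off-triangle x (next x) (next^ t (next x))
       | cong₂ _+_ (off-next x (≤-<-trans (s≤s z≤n) t<k)) (off-next^ t (next x) (<-trans (n<1+n t) t<k))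
  ... | inj₁ e | via-next = trans (sym e) via-next
  ... | inj₂ e | via-next = ⊥-elim (<⇒≱ t<k (subst (k ≤_) (trans (sym e) via-next) (m≤n+m k _)))

  off-next-pred : ∀ {d} (x w : Fin k) → off x w ≡ suc d → off (next x) w ≡ d
  off-next-pred {d} x w e with off-triangle x (next x) w
  ... | inj₁ e′ = suc-injective (trans (cong (_+ off (next x) w) (sym (off-next x 1<k))) (trans e′ e))
    where 1<k = ≤-<-trans (s≤s z≤n) (subst (_< k) e (off< x w))
  ... | inj₂ e′ = ⊥-elim (<⇒≱ (off< (next x) w) (+-cancelˡ-≤ 1 _ _ (begin
    1 + k                              ≤⟨ +-monoˡ-≤ k (s≤s z≤n) ⟩
    suc d + k                          ≡⟨ cong (_+ k) (sym e) ⟩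
    off x w + k                        ≡⟨ sym e′ ⟩
    off x (next x) + off (next x) w    ≡⟨ cong (_+ off (next x) w) (off-next x 1<k) ⟩
    1 + off (next x) w                 ∎)))
    where
    open ≤-Reasoning
    1<k = ≤-<-trans (s≤s z≤n) (subst (_< k) e (off< x w))

  next^-off : (x w : Fin k) → next^ (off x w) x ≡ w
  next^-off x w = go (off x w) x refl
    where
    go : ∀ d x → off x w ≡ d → next^ d x ≡ w
    go zero    x e = off≡0⇒≡ x w e
    go (suc d) x e = go d (next x) (off-next-pred x w e)

  off-next^-≤ : ∀ (o : Fin k) i j → i ≤ j → j < k → i + off (next^ i o) (next^ j o) ≡ j
  off-next^-≤ o i j i≤j j<k = begin
    i + off oᵢ (next^ j o)                ≡⟨ cong (λ t → i + off oᵢ (next^ t o)) (sym (m+[n∸m]≡n i≤j)) ⟩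
    i + off oᵢ (next^ (i + (j ∸ i)) o)    ≡⟨ cong (λ w → i + off oᵢ w) (next^-+ i (j ∸ i) o) ⟩
    i + off oᵢ (next^ (j ∸ i) oᵢ)         ≡⟨ cong (i +_) (off-next^ (j ∸ i) oᵢ (≤-<-trans (m∸n≤m j i) j<k)) ⟩
    i + (j ∸ i)                           ≡⟨ m+[n∸m]≡n i≤j ⟩
    j                                     ∎
    where
    open ≡-Reasoning
    oᵢ = next^ i o

  off-next^-> : ∀ (o : Fin k) i j → j < i → i < k → i + off (next^ i o) (next^ j o) ≡ j + k
  off-next^-> o i j j<i i<k with off-triangle o (next^ i o) (next^ j o)
  ... | inj₂ e = trans (cong (_+ d) (sym (off-next^ i o i<k))) (trans e (cong (_+ k) (off-next^ j o (<-trans j<i i<k))))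
    where d = off (next^ i o) (next^ j o)
  ... | inj₁ e = ⊥-elim (<⇒≱ j<i (begin
    i                       ≤⟨ m≤m+n i d ⟩
    i + d                   ≡⟨ cong (_+ d) (sym (off-next^ i o i<k)) ⟩
    off o (next^ i o) + d   ≡⟨ e ⟩
    off o (next^ j o)       ≡⟨ off-next^ j o (<-trans j<i i<k) ⟩
    j                       ∎))
    where
    open ≤-Reasoning
    d = off (next^ i o) (next^ j o)

  seg-+ : ∀ m n (x : Fin k) → seg x (m + n) ≡ seg x m ++ seg (next^ m x) n
  seg-+ zero    n x = refl
  seg-+ (suc m) n x = cong (x ∷_) (seg-+ m n (next x))

  next^∈seg : ∀ {t L} (x : Fin k) → t < L → next^ t x ∈ seg x L
  next^∈seg {zero}  {suc L} x _         = here refl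
  next^∈seg {suc t} {suc L} x (s≤s t<L) = there (next^∈seg (next x) t<L)

  ∈seg⇒next^ : ∀ {L} {x w : Fin k} → w ∈ seg x L → ∃ λ t → t < L × next^ t x ≡ w
  ∈seg⇒next^ {suc L} (here w≡x) = 0 , s≤s z≤n , sym w≡x
  ∈seg⇒next^ {suc L} (there w∈) with ∈seg⇒next^ w∈
  ... | t , t<L , e = suc t , s≤s t<L , e

  ∈seg⇒off< : ∀ {L} {x w : Fin k} → L ≤ k → w ∈ seg x L → off x w < L
  ∈seg⇒off< {L} {x} L≤k w∈ with ∈seg⇒next^ w∈
  ... | t , t<L , refl = subst (_< L) (sym (off-next^ t x (<-≤-trans t<L L≤k))) t<L

  off<⇒∈seg : ∀ {L} (x w : Fin k) → off x w < L → w ∈ seg x L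
  off<⇒∈seg x w lt = subst (_∈ seg x _) (next^-off x w) (next^∈seg x lt)

  seg-range : ∀ (x : Fin k) n → n < k → seg x (suc n) ≡ range x (next^ n x)
  seg-range x n n<k = cong (λ m → seg x (suc m)) (sym (off-next^ n x n<k))

  toℕ-next^-wrap : ∀ t (x : Fin k) → toℕ x + t ≡ k → toℕ (next^ t x) ≡ 0
  toℕ-next^-wrap zero x e = ⊥-elim (<-irrefl (trans (sym (+-identityʳ _)) e) (toℕ<n x))
  toℕ-next^-wrap (suc t) x e with toℕ-next x
  ... | inj₁ (_ , e′) = toℕ-next^-wrap t (next x) (trans (cong (_+ t) e′) (trans (sym (+-suc _ t)) e))
  ... | inj₂ (x+1≡k , e′) = subst (λ s → toℕ (next^ s (next x)) ≡ 0) (sym t≡0) e′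
    where
    t≡0 : t ≡ 0
    t≡0 = +-cancelˡ-≡ (suc (toℕ x)) t 0
            (trans (sym (+-suc (toℕ x) t)) (trans e (trans (sym x+1≡k) (sym (+-identityʳ _)))))

  take-drop-allFin : ∀ n (x : Fin k) →
    take (suc n) (drop (toℕ x) (allFin k)) ≡ x ∷ take n (drop (suc (toℕ x)) (allFin k))
  take-drop-allFin n x = trans (cong (take (suc n)) (drop-tabulate (toℕ x) (toℕ<n x) id))
                               (cong (λ y → y ∷ take n (drop (suc (toℕ x)) (allFin k))) (fromℕ<-toℕ x (toℕ<n x)))

  seg-take-drop : ∀ n (x : Fin k) → toℕ x + n ≤ k → seg x n ≡ take n (drop (toℕ x) (allFin k))
  seg-take-drop zero    x _ = refl
  seg-take-drop (suc n) x x+n≤k with toℕ-next x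
  ... | inj₁ (_ , e) = trans (cong (x ∷_) tail) (sym (take-drop-allFin n x))
    where
    next-x+n≤k = subst (λ m → m + n ≤ k) (sym e) (subst (_≤ k) (+-suc (toℕ x) n) x+n≤k)
    tail = trans (seg-take-drop n (next x) next-x+n≤k) (cong (λ m → take n (drop m (allFin k))) e)
  ... | inj₂ (x+1≡k , _) = subst (λ m → seg x (suc m) ≡ take (suc m) (drop (toℕ x) (allFin k))) (sym n≡0)
                                 (sym (take-drop-allFin 0 x))
    where
    n≡0 : n ≡ 0
    n≡0 = n≤0⇒n≡0 (+-cancelˡ-≤ (suc (toℕ x)) n 0 (begin
      suc (toℕ x) + n   ≡⟨ sym (+-suc (toℕ x) n) ⟩
      toℕ x + suc n     ≤⟨ x+n≤k ⟩
      k                 ≡⟨ sym x+1≡k ⟩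
      suc (toℕ x)       ≡⟨ sym (+-identityʳ _) ⟩
      suc (toℕ x) + 0   ∎))
      where open ≤-Reasoning

  seg-rotation : (o : Fin k) → seg o k ≡ drop (toℕ o) (allFin k) ++ take (toℕ o) (allFin k)
  seg-rotation o = begin
    seg o k                              ≡⟨ cong (seg o) (sym (m∸n+n≡m o≤k)) ⟩
    seg o (m + toℕ o)                    ≡⟨ seg-+ m (toℕ o) o ⟩
    seg o m ++ seg (next^ m o) (toℕ o)   ≡⟨ cong₂ _++_ tail-part head-part ⟩
    drop (toℕ o) (allFin k) ++ take (toℕ o) (allFin k) ∎
    where
    open ≡-Reasoning
    o≤k = <⇒≤ (toℕ<n o)
    m = k ∸ toℕ o
    tail-part : seg o m ≡ drop (toℕ o) (allFin k)
    tail-part = trans (seg-take-drop m o (≤-reflexive (m+[n∸m]≡n o≤k)))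
      (take-all m _ (≤-reflexive (trans (length-drop (toℕ o) (allFin k)) (cong (_∸ toℕ o) (length-tabulate id)))))
    wrapped : toℕ (next^ m o) ≡ 0
    wrapped = toℕ-next^-wrap m o (m+[n∸m]≡n o≤k)
    head-part : seg (next^ m o) (toℕ o) ≡ take (toℕ o) (allFin k)
    head-part = trans (seg-take-drop (toℕ o) (next^ m o) (subst (λ z → z + toℕ o ≤ k) (sym wrapped) o≤k))
      (cong (λ z → take (toℕ o) (drop z (allFin k))) wrapped)

  Full : List (Fin k) → Set
  Full R = ∀ w → w ∈ R

  off-pred : (x p : Fin k) → 1 < k → next p ≡ x → off x p + 1 ≡ k
  off-pred x p 1<k np≡x with off-triangle x p (next p)
  ... | inj₁ e = ⊥-elim (0≢1+n (begin
    0                             ≡⟨ sym (off-refl x) ⟩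
    off x x                       ≡⟨ cong (off x) (sym np≡x) ⟩
    off x (next p)                ≡⟨ sym e ⟩
    off x p + off p (next p)      ≡⟨ cong (off x p +_) (off-next p 1<k) ⟩
    off x p + 1                   ≡⟨ +-comm (off x p) 1 ⟩
    suc (off x p)                 ∎))
    where open ≡-Reasoning
  ... | inj₂ e = begin
    off x p + 1                   ≡⟨ cong (off x p +_) (sym (off-next p 1<k)) ⟩
    off x p + off p (next p)      ≡⟨ e ⟩
    off x (next p) + k            ≡⟨ cong (λ w → off x w + k) np≡x ⟩
    off x x + k                   ≡⟨ cong (_+ k) (off-refl x) ⟩
    k                             ∎
    where open ≡-Reasoning

  -- If x ≠ x', the predecessor of x lies in seg x' L' ⊆ seg x L, which forces seg x L to wrap around.
  seg-start-unique : ∀ {L L'} {x x' : Fin k} → L ≤ k → L' ≤ k →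
    x ∈ seg x' L' → seg x' L' ⊆ seg x L → (Full (seg x L) → Irrelevant (Fin k)) → x ≡ x'
  seg-start-unique {L} {L'} {x} {x'} L≤k L'≤k x∈ ⊆seg full⇒trivial with off x' x in eq
  ... | zero  = sym (off≡0⇒≡ x' x eq)
  ... | suc d = full⇒trivial full x x'
    where
    p = next^ d x'
    1<k : 1 < k
    1<k = ≤-<-trans (s≤s z≤n) (subst (_< k) eq (off< x' x))
    next-p : next p ≡ x
    next-p = trans (sym (next^-suc d x')) (trans (cong (λ t → next^ t x') (sym eq)) (next^-off x' x))
    p∈ : p ∈ seg x L
    p∈ = ⊆seg (next^∈seg x' (<-trans (n<1+n d) (subst (_< L') eq (∈seg⇒off< L'≤k x∈))))
    k≤L : k ≤ L
    k≤L = subst (_≤ L) (trans (+-comm 1 (off x p)) (off-pred x p 1<k next-p)) (∈seg⇒off< L≤k p∈)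
    full : Full (seg x L)
    full w = off<⇒∈seg x w (<-≤-trans (off< x w) k≤L)

  seg-⊆⇒≤ : ∀ {L L'} (x : Fin k) → L ≤ k → seg x L ⊆ seg x L' → L' ≤ k → L ≤ L'
  seg-⊆⇒≤ {L} {L'} x L≤k ⊆seg L'≤k with L ≤? L'
  ... | yes L≤L' = L≤L'
  ... | no L≰L'  = ⊥-elim (<-irrefl (off-next^ L' x L'<k) (∈seg⇒off< L'≤k (⊆seg (next^∈seg x (≰⇒> L≰L')))))
    where L'<k = <-≤-trans (≰⇒> L≰L') L≤k

  -- A range covering all of ℬ can start anywhere, hence the last hypothesis.
  IsRange-unique : ∀ {R R'} → IsRange R → IsRange R' → R ⊆ R' → R' ⊆ R →
    (Full R → Irrelevant (Fin k)) → R ≡ R'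
  IsRange-unique (inj₁ refl) (inj₁ refl) _ _ _ = refl
  IsRange-unique (inj₁ refl) (inj₂ (_ , _ , refl)) _ R'⊆R _ with R'⊆R (here refl)
  ... | ()
  IsRange-unique (inj₂ (_ , _ , refl)) (inj₁ refl) R⊆R' _ _ with R⊆R' (here refl)
  ... | ()
  IsRange-unique (inj₂ (x , y , refl)) (inj₂ (x' , y' , refl)) R⊆R' R'⊆R full⇒trivial
    with seg-start-unique (off< x y) (off< x' y') (R⊆R' (here refl)) R'⊆R full⇒trivial
  ... | refl = cong (λ L → seg x (suc L)) (suc-injective (≤-antisym
          (seg-⊆⇒≤ x (off< x y) R⊆R' (off< x y')) (seg-⊆⇒≤ x (off< x y') R'⊆R (off< x y))))

module _ {k : ℕ} {F : Fin k → Fin k} where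

  Adj-sym : ∀ {u w} → Adj F u w → Adj F w u
  Adj-sym = swap

  CoReach-trans : ∀ {u v w} → CoReach F u v → CoReach F v w → CoReach F u w
  CoReach-trans p here            = p
  CoReach-trans p (step q u≢w ¬a) = step (CoReach-trans p q) u≢w ¬a

  CoReach-sym : ∀ {u v} → CoReach F u v → CoReach F v u
  CoReach-sym here                 = here
  CoReach-sym (step {u} {w} p u≢w ¬a) = CoReach-trans (step here (u≢w ∘ sym) (¬a ∘ Adj-sym {w} {u})) (CoReach-sym p)

  module CoBipartition {v : Fin k} {X Y : List (Fin k)} (B : IsCoBipartitionOf F v X Y) where

    reachable : ∀ {w} → w ∈ X ⊎ w ∈ Y → CoReach F v w
    reachable = proj₁ B _

    covered : ∀ {w} → CoReach F v w → w ∈ X ⊎ w ∈ Y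
    covered = proj₁ (proj₂ B) _

    disjoint : ∀ {w} → w ∈ X → ¬ w ∈ Y
    disjoint = proj₁ (proj₂ (proj₂ B)) _

    cliqueˡ : IsClique F X
    cliqueˡ = proj₁ (proj₂ (proj₂ (proj₂ B)))

    cliqueʳ : IsClique F Y
    cliqueʳ = proj₂ (proj₂ (proj₂ (proj₂ B)))

    swapped : IsCoBipartitionOf F v Y X
    swapped = (λ w → reachable ∘ swap) , (λ w → swap ∘ covered) , (λ w w∈Y w∈X → disjoint w∈X w∈Y)
            , cliqueʳ , cliqueˡ

    Full-ˡ⇒trivial : v ∈ X → Full X → Irrelevant (Fin k)
    Full-ˡ⇒trivial _ full a b = trans (only-v (reachable (inj₁ (full a)))) (sym (only-v (reachable (inj₁ (full b)))))
      where
      only-v : ∀ {w} → CoReach F v w → w ≡ v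
      only-v here = refl
      only-v (step {u} {w} _ u≢w ¬a) = ⊥-elim (¬a (cliqueˡ (full u) (full w) u≢w))

    Full-ʳ⇒trivial : v ∈ X → Full Y → Irrelevant (Fin k)
    Full-ʳ⇒trivial v∈X full = ⊥-elim (disjoint v∈X (full v))

  open CoBipartition using (swapped)

  -- Each non-edge crosses between the two cliques, so the side of a vertex is forced by its co-path from v.
  module SameSides {v v' : Fin k} {X Y X' Y' : List (Fin k)}
    (B : IsCoBipartitionOf F v X Y) (B' : IsCoBipartitionOf F v' X' Y')
    (v'↝v : CoReach F v' v) (v∈X : v ∈ X) (v∈X' : v ∈ X') where

    module B  = CoBipartition B
    module B' = CoBipartition B'

    sides-agree : ∀ {w} → CoReach F v w → (w ∈ X × w ∈ X') ⊎ (w ∈ Y × w ∈ Y')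
    sides-agree here = inj₁ (v∈X , v∈X')
    sides-agree (step {u} {w} p u≢w ¬a)
      with sides-agree p | B.covered (step p u≢w ¬a) | B'.covered (CoReach-trans v'↝v (step p u≢w ¬a))
    ... | inj₁ (u∈X , _)   | inj₁ w∈X  | _          = ⊥-elim (¬a (B.cliqueˡ u∈X w∈X u≢w))
    ... | inj₁ (_ , u∈X')  | inj₂ _    | inj₁ w∈X'  = ⊥-elim (¬a (B'.cliqueˡ u∈X' w∈X' u≢w))
    ... | inj₁ _           | inj₂ w∈Y  | inj₂ w∈Y'  = inj₂ (w∈Y , w∈Y')
    ... | inj₂ (u∈Y , _)   | inj₂ w∈Y  | _          = ⊥-elim (¬a (B.cliqueʳ u∈Y w∈Y u≢w))
    ... | inj₂ (_ , u∈Y')  | inj₁ _    | inj₂ w∈Y'  = ⊥-elim (¬a (B'.cliqueʳ u∈Y' w∈Y' u≢w))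
    ... | inj₂ _           | inj₁ w∈X  | inj₁ w∈X'  = inj₁ (w∈X , w∈X')

    reachable' : ∀ {w} → w ∈ X' ⊎ w ∈ Y' → CoReach F v w
    reachable' = CoReach-trans (CoReach-sym v'↝v) ∘ B'.reachable

    X⊆X' : X ⊆ X'
    X⊆X' w∈X with sides-agree (B.reachable (inj₁ w∈X))
    ... | inj₁ (_ , w∈X') = w∈X'
    ... | inj₂ (w∈Y , _)  = ⊥-elim (B.disjoint w∈X w∈Y)

    X'⊆X : X' ⊆ X
    X'⊆X w∈X' with sides-agree (reachable' (inj₁ w∈X'))
    ... | inj₁ (w∈X , _)  = w∈X
    ... | inj₂ (_ , w∈Y') = ⊥-elim (B'.disjoint w∈X' w∈Y')

    Y⊆Y' : Y ⊆ Y'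
    Y⊆Y' w∈Y with sides-agree (B.reachable (inj₂ w∈Y))
    ... | inj₂ (_ , w∈Y') = w∈Y'
    ... | inj₁ (w∈X , _)  = ⊥-elim (B.disjoint w∈X w∈Y)

    Y'⊆Y : Y' ⊆ Y
    Y'⊆Y w∈Y' with sides-agree (reachable' (inj₂ w∈Y'))
    ... | inj₂ (w∈Y , _)  = w∈Y
    ... | inj₁ (_ , w∈X') = ⊥-elim (B'.disjoint w∈X' w∈Y')

    same-pair : IsRange X → IsRange Y → IsRange X' → IsRange Y' → (X , Y) ≡ (X' , Y')
    same-pair rX rY rX' rY' = cong₂ _,_
      (IsRange-unique rX rX' X⊆X' X'⊆X (B.Full-ˡ⇒trivial v∈X))
      (IsRange-unique rY rY' Y⊆Y' Y'⊆Y (B.Full-ʳ⇒trivial v∈X))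

  co-bipartition-unique : ∀ {v v' : Fin k} {X Y X' Y' : List (Fin k)} →
    IsCoBipartitionOf F v X Y → IsCoBipartitionOf F v' X' Y' → CoReach F v' v →
    IsRange X → IsRange Y → IsRange X' → IsRange Y' →
    (X , Y) ≡ (X' , Y') ⊎ (X , Y) ≡ (Y' , X')
  co-bipartition-unique {v} {X = X} {Y} {X'} {Y'} B B' v'↝v rX rY rX' rY' =
    by-sides (CoBipartition.covered B here) (CoBipartition.covered B' v'↝v)
    where
    same-pair = λ {X Y X' Y'} B B' → SameSides.same-pair {X = X} {Y} {X'} {Y'} B B' v'↝v
    by-sides : v ∈ X ⊎ v ∈ Y → v ∈ X' ⊎ v ∈ Y' → (X , Y) ≡ (X' , Y') ⊎ (X , Y) ≡ (Y' , X')
    by-sides (inj₁ v∈X) (inj₁ v∈X') = inj₁ (same-pair B B' v∈X v∈X' rX rY rX' rY')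
    by-sides (inj₁ v∈X) (inj₂ v∈Y') = inj₂ (same-pair B (swapped B') v∈X v∈Y' rX rY rY' rX')
    by-sides (inj₂ v∈Y) (inj₁ v∈X') = inj₂ (cong ×-swap (same-pair (swapped B) B' v∈Y v∈X' rY rX rX' rY'))
    by-sides (inj₂ v∈Y) (inj₂ v∈Y') = inj₁ (cong ×-swap (same-pair (swapped B) (swapped B') v∈Y v∈Y' rY rX rY' rX'))

∈-Rotation : ∀ {k} {xs} (v : Fin k) → Rotation xs → v ∈ xs
∈-Rotation {k} v (m , refl)
  with ∈-++⁻ (take m (allFin k)) (subst (v ∈_) (sym (take++drop≡id m (allFin k))) (∈-allFin v))
... | inj₁ v∈take = ∈-++⁺ʳ _ v∈take
... | inj₂ v∈drop = ∈-++⁺ˡ v∈drop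

∈-concat-map : ∀ {A B : Set} (f : A → List B) (ps : List A) {v} →
  v ∈ concat (map f ps) → ∃ λ p → p ∈ ps × v ∈ f p
∈-concat-map f ps v∈ with ∈-concat⁻′ (map f ps) v∈
... | _ , v∈xs , xs∈ with ∈-map⁻ f xs∈
...   | p , p∈ps , refl = p , p∈ps , v∈xs

module _ {k : ℕ} {F : Fin k → Fin k} where

  -- A co-contig pair through v is pinned down by the listed pair containing v.
  co-contig-pairs-complete : ∀ {ps : List (List (Fin k) × List (Fin k))} → All (IsCoContigPair F) ps →
    (∀ v → v ∈ concat (map proj₁ ps) ++ concat (map proj₂ ps)) →
    ∀ X Y → IsCoContigPair F (X , Y) → (X , Y) ∈ ps ⊎ (Y , X) ∈ ps
  co-contig-pairs-complete {ps} all-contig covers X Y (rX , rY , v , B) =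
    locate (∈-++⁻ (concat (map proj₁ ps)) (covers v))
    where
    match : ∀ {X' Y'} → (X' , Y') ∈ ps → v ∈ X' ⊎ v ∈ Y' → (X , Y) ∈ ps ⊎ (Y , X) ∈ ps
    match p∈ps v∈p with lookup all-contig p∈ps
    ... | rX' , rY' , _ , B' with co-bipartition-unique B B' (CoBipartition.reachable B' v∈p) rX rY rX' rY'
    ...   | inj₁ refl = inj₁ p∈ps
    ...   | inj₂ refl = inj₂ p∈ps

    locate : v ∈ concat (map proj₁ ps) ⊎ v ∈ concat (map proj₂ ps) → (X , Y) ∈ ps ⊎ (Y , X) ∈ ps
    locate (inj₁ v∈ˡ) = let _ , p∈ps , v∈X' = ∈-concat-map proj₁ ps v∈ˡ in match p∈ps (inj₁ v∈X')
    locate (inj₂ v∈ʳ) = let _ , p∈ps , v∈Y' = ∈-concat-map proj₂ ps v∈ʳ in match p∈ps (inj₂ v∈Y')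

  natural-ordering : ∀ {ps : List (List (Fin k) × List (Fin k))} → All (IsCoContigPair F) ps →
    Rotation (concat (map proj₁ ps) ++ concat (map proj₂ ps)) → NaturalOrdering F ps
  natural-ordering all-contig rot = all-contig , co-contig-pairs-complete all-contig (λ v → ∈-Rotation v rot) , rot

reach : ∀ {k} → (Fin k → Fin k) → Fin k → ℕ
reach F a = off a (F a)

module _ {k} {F : Fin k → Fin k} (R : IsRoundRep F) where

  reach-next : ∀ a → reach F a ≤ 1 + reach F (next a)
  reach-next a = begin
    off a (F a)                                  ≤⟨ R a ⟩
    off a (F (next a))                           ≤⟨ off-triangle-≤ a (next a) (F (next a)) ⟩
    off a (next a) + off (next a) (F (next a))   ≤⟨ +-monoˡ-≤ _ (off-next≤1 a) ⟩
    1 + reach F (next a)                         ∎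
    where open ≤-Reasoning

  reach-next^ : ∀ t a → reach F a ≤ t + reach F (next^ t a)
  reach-next^ zero    a = ≤-refl
  reach-next^ (suc t) a = ≤-trans (reach-next a) (s≤s (reach-next^ t (next a)))

  +reach-mono : ∀ (o : Fin k) {i j} → i ≤ j → i + reach F (next^ i o) ≤ j + reach F (next^ j o)
  +reach-mono o {i} {j} i≤j = begin
    i + reach F oᵢ                               ≤⟨ +-monoʳ-≤ i (reach-next^ (j ∸ i) oᵢ) ⟩
    i + ((j ∸ i) + reach F (next^ (j ∸ i) oᵢ))   ≡⟨ sym (+-assoc i (j ∸ i) _) ⟩
    i + (j ∸ i) + reach F (next^ (j ∸ i) oᵢ)     ≡⟨ cong₂ (λ s t → s + reach F t) i+[j∸i]≡j (sym (next^-+ i (j ∸ i) o)) ⟩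
    j + reach F (next^ (i + (j ∸ i)) o)          ≡⟨ cong (λ t → j + reach F (next^ t o)) i+[j∸i]≡j ⟩
    j + reach F (next^ j o)                      ∎
    where
    open ≤-Reasoning
    oᵢ = next^ i o
    i+[j∸i]≡j = m+[n∸m]≡n i≤j

module Positions {k} (F : Fin k → Fin k) (o : Fin k) where

  V : ℕ → Fin k
  V i = next^ i o

  pos : Fin k → ℕ
  pos w = off o w

  V-pos : ∀ w → V (pos w) ≡ w
  V-pos = next^-off o

  pos-V : ∀ {i} → i < k → pos (V i) ≡ i
  pos-V {i} = off-next^ i o

  V-injective : ∀ {i j} → i < j → j < k → V i ≢ V j
  V-injective {i} {j} i<j j<k Vi≡Vj =
    <-irrefl (trans (sym (pos-V (<-trans i<j j<k))) (trans (cong pos Vi≡Vj) (pos-V j<k))) i<j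

  module _ {i j : ℕ} (i<j : i < j) (j<k : j < k) where

    off-forward : i + off (V i) (V j) ≡ j
    off-forward = off-next^-≤ o i j (<⇒≤ i<j) j<k

    off-backward : j + off (V j) (V i) ≡ i + k
    off-backward = off-next^-> o j i i<j j<k

    Arrow-forward⇒ : Arrow F (V i) (V j) → j ≤ i + reach F (V i)
    Arrow-forward⇒ (_ , d≤reach) = subst (_≤ i + reach F (V i)) off-forward (+-monoʳ-≤ i d≤reach)

    Arrow-forward⇐ : j ≤ i + reach F (V i) → Arrow F (V i) (V j)
    Arrow-forward⇐ j≤ = off>0 (V i) (V j) (V-injective i<j j<k)
                      , +-cancelˡ-≤ i _ _ (subst (_≤ i + reach F (V i)) (sym off-forward) j≤)

    Arrow-backward⇒ : Arrow F (V j) (V i) → i + k ≤ j + reach F (V j)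
    Arrow-backward⇒ (_ , d≤reach) = subst (_≤ j + reach F (V j)) off-backward (+-monoʳ-≤ j d≤reach)

    Arrow-backward⇐ : i + k ≤ j + reach F (V j) → Arrow F (V j) (V i)
    Arrow-backward⇐ ≤j = off>0 (V j) (V i) (V-injective i<j j<k ∘ sym)
                       , +-cancelˡ-≤ j _ _ (subst (_≤ j + reach F (V j)) (sym off-backward) ≤j)

  -- Neither of the arcs of V i and V j reaches the other one.
  Apart : ℕ → ℕ → Set
  Apart i j = i + reach F (V i) < j × j + reach F (V j) < i + k

  Apart⇒¬Adj : ∀ {i j} → i < j → j < k → Apart i j → ¬ Adj F (V i) (V j)
  Apart⇒¬Adj i<j j<k (fwd , _) (inj₁ arrow) = <⇒≱ fwd (Arrow-forward⇒ i<j j<k arrow)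
  Apart⇒¬Adj i<j j<k (_ , bwd) (inj₂ arrow) = <⇒≱ bwd (Arrow-backward⇒ i<j j<k arrow)

  ¬Adj⇒Apart : ∀ {i j} → i < j → j < k → ¬ Adj F (V i) (V j) → Apart i j
  ¬Adj⇒Apart {i} {j} i<j j<k ¬adj = ≰⇒> (¬adj ∘ inj₁ ∘ Arrow-forward⇐ i<j j<k)
                                  , ≰⇒> (¬adj ∘ inj₂ ∘ Arrow-backward⇐ i<j j<k)

+-≤-tight : ∀ {m n p q} → m + n ≤ p + q → p ≤ m → q ≤ n → m ≤ p × n ≤ q
+-≤-tight ≤+ p≤m q≤n = ≮⇒≥ (λ p<m → <⇒≱ (+-mono-<-≤ p<m q≤n) ≤+)
                      , ≮⇒≥ (λ q<n → <⇒≱ (+-mono-≤-< p≤m q<n) ≤+)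

anyIn? : ∀ {P : ℕ → Set} → (∀ i → Dec (P i)) → ∀ a x → Dec (∃ λ i → (a ≤ i × i < x) × P i)
anyIn? P? a x = map′ (λ (i , i<x , a≤i , p) → i , (a≤i , i<x) , p) (λ (i , (a≤i , i<x) , p) → i , i<x , a≤i , p)
                     (anyUpTo? (λ i → (a ≤? i) ×-dec P? i) x)

module Frame {k} {F : Fin k → Fin k} (R : IsRoundRep F) (o : Fin k) (h : ℕ) (h≤k : h ≤ k)
  (cliqueˡ : ∀ {i j} → i < j → j < h → Adj F (next^ i o) (next^ j o))
  (cliqueʳ : ∀ {i j} → h ≤ i → i < j → j < k → Adj F (next^ i o) (next^ j o)) where

  open Positions F o

  CoEdge : ℕ → ℕ → Set
  CoEdge i j = i < h × h ≤ j × j < k × Apart i j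

  coEdge? : ∀ i j → Dec (CoEdge i j)
  coEdge? i j = i <? h ×-dec h ≤? j ×-dec j <? k ×-dec i + reach F (V i) <? j ×-dec j + reach F (V j) <? i + k

  CoEdge⇒≢ : ∀ {i j} → CoEdge i j → V i ≢ V j
  CoEdge⇒≢ (i<h , h≤j , j<k , _) = V-injective (<-≤-trans i<h h≤j) j<k

  CoEdge⇒¬Adj : ∀ {i j} → CoEdge i j → ¬ Adj F (V i) (V j)
  CoEdge⇒¬Adj (i<h , h≤j , j<k , apart) = Apart⇒¬Adj (<-≤-trans i<h h≤j) j<k apart

  ¬Adj-V⇒CoEdge : ∀ {i j} → i < j → j < k → ¬ Adj F (V i) (V j) → CoEdge i j
  ¬Adj-V⇒CoEdge {i} {j} i<j j<k ¬adj with j <? h | h ≤? i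
  ... | yes j<h | _        = ⊥-elim (¬adj (cliqueˡ i<j j<h))
  ... | no _    | yes h≤i  = ⊥-elim (¬adj (cliqueʳ h≤i i<j j<k))
  ... | no j≮h  | no h≰i   = ≰⇒> h≰i , ≮⇒≥ j≮h , j<k , ¬Adj⇒Apart i<j j<k ¬adj

  wlog-position : ∀ {P : Fin k → Fin k → Set} → (∀ {u w} → P u w → P w u) →
    (∀ {i j} → i < j → j < k → P (V i) (V j)) → ∀ {u w} → u ≢ w → P u w
  wlog-position {P} symm ordered {u} {w} u≢w with <-cmp (pos u) (pos w)
  ... | tri< lt _ _ = subst₂ P (V-pos u) (V-pos w) (ordered lt (off< o w))
  ... | tri≈ _ eq _ = ⊥-elim (u≢w (trans (sym (V-pos u)) (trans (cong V eq) (V-pos w))))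
  ... | tri> _ _ gt = symm (subst₂ P (V-pos w) (V-pos u) (ordered gt (off< o u)))

  ¬Adj⇒CoEdge : ∀ {u w} → u ≢ w → ¬ Adj F u w → CoEdge (pos u) (pos w) ⊎ CoEdge (pos w) (pos u)
  ¬Adj⇒CoEdge = wlog-position {P = λ u w → ¬ Adj F u w → CoEdge (pos u) (pos w) ⊎ CoEdge (pos w) (pos u)}
    (λ {u} {w} p ¬adj → swap (p (¬adj ∘ Adj-sym {F = F} {u} {w})))
    (λ {i} {j} i<j j<k ¬adj →
      inj₁ (subst₂ CoEdge (sym (pos-V (<-trans i<j j<k))) (sym (pos-V j<k)) (¬Adj-V⇒CoEdge i<j j<k ¬adj)))

  Adj-left : ∀ {u w} → u ≢ w → pos u < h → pos w < h → Adj F u w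
  Adj-left = wlog-position {P = λ u w → pos u < h → pos w < h → Adj F u w}
    (λ {u} {w} p w<h u<h → Adj-sym {F = F} {u} {w} (p u<h w<h))
    (λ {i} {j} i<j j<k _ j<h → cliqueˡ i<j (subst (_< h) (pos-V j<k) j<h))

  Adj-right : ∀ {u w} → u ≢ w → h ≤ pos u → h ≤ pos w → Adj F u w
  Adj-right = wlog-position {P = λ u w → h ≤ pos u → h ≤ pos w → Adj F u w}
    (λ {u} {w} p h≤w h≤u → Adj-sym {F = F} {u} {w} (p h≤u h≤w))
    (λ {i} {j} i<j j<k h≤i _ → cliqueʳ (subst (h ≤_) (pos-V (<-trans i<j j<k)) h≤i) i<j j<k)

  +reach-mono-V : ∀ {i j} → i ≤ j → i + reach F (V i) ≤ j + reach F (V j)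
  +reach-mono-V = +reach-mono R o

  CoEdge-betweenʳ : ∀ {i j₁ j₂ j₃} → CoEdge i j₁ → CoEdge i j₃ → j₁ ≤ j₂ → j₂ ≤ j₃ → CoEdge i j₂
  CoEdge-betweenʳ (i<h , h≤j₁ , _ , fwd , _) (_ , _ , j₃<k , _ , bwd) j₁≤j₂ j₂≤j₃ =
    i<h , ≤-trans h≤j₁ j₁≤j₂ , ≤-<-trans j₂≤j₃ j₃<k
        , <-≤-trans fwd j₁≤j₂ , ≤-<-trans (+reach-mono-V j₂≤j₃) bwd

  CoEdge-betweenˡ : ∀ {i₁ i₂ i₃ j} → CoEdge i₁ j → CoEdge i₃ j → i₁ ≤ i₂ → i₂ ≤ i₃ → CoEdge i₂ j
  CoEdge-betweenˡ (_ , h≤j , j<k , _ , bwd) (i₃<h , _ , _ , fwd , _) i₁≤i₂ i₂≤i₃ =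
    ≤-<-trans i₂≤i₃ i₃<h , h≤j , j<k
      , ≤-<-trans (+reach-mono-V i₂≤i₃) fwd , <-≤-trans bwd (+-monoˡ-≤ k i₁≤i₂)

  CoEdge-corner : ∀ {a b i j} → a ≤ i → b ≤ j → CoEdge a j → CoEdge i b → CoEdge a b
  CoEdge-corner a≤i b≤j (a<h , _ , _ , _ , bwd) (_ , h≤b , b<k , fwd , _) =
    a<h , h≤b , b<k , ≤-<-trans (+reach-mono-V a≤i) fwd , ≤-<-trans (+reach-mono-V b≤j) bwd

  In : ℕ → ℕ → ℕ → Set
  In a x i = a ≤ i × i < x

  In-single : ∀ {a i} → In a (suc a) i → i ≡ a
  In-single (a≤i , i≤a) = ≤-antisym (s≤s⁻¹ i≤a) a≤i

  In-suc : ∀ {a x i} → In a (suc x) i → In a x i ⊎ i ≡ x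
  In-suc (a≤i , i≤x) with m≤n⇒m<n∨m≡n (s≤s⁻¹ i≤x)
  ... | inj₁ i<x = inj₁ (a≤i , i<x)
  ... | inj₂ i≡x = inj₂ i≡x

  In-widen : ∀ {a x i} → In a x i → In a (suc x) i
  In-widen (a≤i , i<x) = a≤i , m≤n⇒m≤1+n i<x

  block : ℕ → ℕ → List (Fin k)
  block a x = seg (V a) (x ∸ a)

  next^-V : ∀ a t → next^ t (V a) ≡ V (a + t)
  next^-V a t = sym (next^-+ a t o)

  ∈block⇒In : ∀ {a x w} → a ≤ x → x ≤ k → w ∈ block a x → In a x (pos w)
  ∈block⇒In {a} {x} a≤x x≤k w∈ with ∈seg⇒next^ w∈
  ... | t , t<x∸a , refl = subst (In a x) (sym pos≡) (m≤m+n a t , a+t<x)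
    where
    a+t<x : a + t < x
    a+t<x = subst (a + t <_) (m+[n∸m]≡n a≤x) (+-monoʳ-< a t<x∸a)
    pos≡ : pos (next^ t (V a)) ≡ a + t
    pos≡ = trans (cong pos (next^-V a t)) (pos-V (<-≤-trans a+t<x x≤k))

  In⇒∈block : ∀ {a x w} → In a x (pos w) → w ∈ block a x
  In⇒∈block {a} {x} {w} (a≤w , w<x) = subst (_∈ block a x) V-w (next^∈seg (V a) (∸-monoˡ-< w<x a≤w))
    where
    V-w : next^ (pos w ∸ a) (V a) ≡ w
    V-w = trans (next^-V a (pos w ∸ a)) (trans (cong V (m+[n∸m]≡n a≤w)) (V-pos w))

  block-IsRange : ∀ {a x} → a ≤ x → x ≤ k → IsRange (block a x)
  block-IsRange {a} {x} a≤x x≤k with x ∸ a in len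
  ... | zero  = inj₁ refl
  ... | suc m = inj₂ (V a , next^ m (V a) , seg-range (V a) m m<k)
    where
    m<k : m < k
    m<k = <-≤-trans (subst (m <_) (sym len) (n<1+n m)) (≤-trans (m∸n≤m x a) x≤k)

  block-++ : ∀ {a x y} → a ≤ x → x ≤ y → block a y ≡ block a x ++ block x y
  block-++ {a} {x} {y} a≤x x≤y = begin
    seg (V a) (y ∸ a)                                        ≡⟨ cong (seg (V a)) (sym lengths) ⟩
    seg (V a) ((x ∸ a) + (y ∸ x))                            ≡⟨ seg-+ (x ∸ a) (y ∸ x) (V a) ⟩
    block a x ++ seg (next^ (x ∸ a) (V a)) (y ∸ x)           ≡⟨ cong (λ z → block a x ++ seg z (y ∸ x)) V-x ⟩
    block a x ++ block x y                                   ∎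
    where
    open ≡-Reasoning
    lengths : (x ∸ a) + (y ∸ x) ≡ y ∸ a
    lengths = +-cancelˡ-≡ a _ _ (begin
      a + ((x ∸ a) + (y ∸ x))   ≡⟨ sym (+-assoc a (x ∸ a) (y ∸ x)) ⟩
      a + (x ∸ a) + (y ∸ x)     ≡⟨ cong (_+ (y ∸ x)) (m+[n∸m]≡n a≤x) ⟩
      x + (y ∸ x)               ≡⟨ m+[n∸m]≡n x≤y ⟩
      y                         ≡⟨ sym (m+[n∸m]≡n (≤-trans a≤x x≤y)) ⟩
      a + (y ∸ a)               ∎)
    V-x : next^ (x ∸ a) (V a) ≡ V x
    V-x = trans (next^-V a (x ∸ a)) (cong V (m+[n∸m]≡n a≤x))

  NoCoEdge : (ℕ → Set) → (ℕ → Set) → Set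
  NoCoEdge P Q = ∀ {i j} → P i → Q j → ¬ CoEdge i j

  -- The co-components inside [0, a) ∪ [h, b) are cut off from the rest.
  Separated : ℕ → ℕ → Set
  Separated a b = NoCoEdge (_< a) (b ≤_) × NoCoEdge (a ≤_) (_< b)

  Closed : ℕ → ℕ → ℕ → ℕ → Set
  Closed a x b y = NoCoEdge (In a x) (y ≤_) × NoCoEdge (x ≤_) (In b y)

  Separated-next : ∀ {a b x y} → a ≤ x → b ≤ y → Separated a b → Closed a x b y → Separated x y
  Separated-next {a} {b} {x} {y} a≤x b≤y (sep₁ , sep₂) (closed₁ , closed₂) = below , above
    where
    below : NoCoEdge (_< x) (y ≤_)
    below {i} i<x y≤j with i <? a
    ... | yes i<a = sep₁ i<a (≤-trans b≤y y≤j)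
    ... | no i≮a  = closed₁ (≮⇒≥ i≮a , i<x) y≤j
    above : NoCoEdge (x ≤_) (_< y)
    above {j = j} x≤i j<y with j <? b
    ... | yes j<b = sep₂ (≤-trans a≤x x≤i) j<b
    ... | no j≮b  = closed₂ x≤i (≮⇒≥ j≮b , j<y)

  InBlocks : ℕ → ℕ → ℕ → ℕ → Fin k → Set
  InBlocks a x b y w = In a x (pos w) ⊎ In b y (pos w)

  module Blocks {a x b y : ℕ} (a≤x : a ≤ x) (x≤h : x ≤ h) (h≤b : h ≤ b) (b≤y : b ≤ y) (y≤k : y ≤ k)
                (sep : Separated a b) (closed : Closed a x b y) where

    InBlocks-step : ∀ {u w} → InBlocks a x b y u → u ≢ w → ¬ Adj F u w → InBlocks a x b y w
    InBlocks-step {u} {w} u∈ u≢w ¬adj with u∈ | ¬Adj⇒CoEdge u≢w ¬adj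
    ... | inj₁ (_ , u<x) | inj₂ (_ , h≤u , _) = ⊥-elim (<⇒≱ u<x (≤-trans x≤h h≤u))
    ... | inj₂ (b≤u , _) | inj₁ (u<h , _)     = ⊥-elim (<⇒≱ u<h (≤-trans h≤b b≤u))
    ... | inj₁ u∈ˡ@(a≤u , _) | inj₁ e with pos w <? b | pos w <? y
    ...   | yes w<b | _      = ⊥-elim (proj₂ sep a≤u w<b e)
    ...   | no w≮b  | yes w<y = inj₂ (≮⇒≥ w≮b , w<y)
    ...   | no _    | no w≮y  = ⊥-elim (proj₁ closed u∈ˡ (≮⇒≥ w≮y) e)
    InBlocks-step {u} {w} u∈ u≢w ¬adj | inj₂ u∈ʳ@(b≤u , _) | inj₂ e with pos w <? a | pos w <? x
    ...   | yes w<a | _       = ⊥-elim (proj₁ sep w<a b≤u e)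
    ...   | no w≮a  | yes w<x = inj₁ (≮⇒≥ w≮a , w<x)
    ...   | no _    | no w≮x  = ⊥-elim (proj₂ closed (≮⇒≥ w≮x) u∈ʳ e)

    InBlocks-closed : ∀ {r w} → InBlocks a x b y r → CoReach F r w → InBlocks a x b y w
    InBlocks-closed r∈ here             = r∈
    InBlocks-closed r∈ (step p u≢w ¬adj) = InBlocks-step (InBlocks-closed r∈ p) u≢w ¬adj

    x≤k = ≤-trans x≤h h≤k

    ∈ˡ⇒<h : ∀ {w} → w ∈ block a x → pos w < h
    ∈ˡ⇒<h w∈ = <-≤-trans (proj₂ (∈block⇒In a≤x x≤k w∈)) x≤h

    ∈ʳ⇒≥h : ∀ {w} → w ∈ block b y → h ≤ pos w
    ∈ʳ⇒≥h w∈ = ≤-trans h≤b (proj₁ (∈block⇒In b≤y y≤k w∈))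

    co-contig : (r : Fin k) → InBlocks a x b y r → (∀ {w} → InBlocks a x b y w → CoReach F r w) →
      IsCoContigPair F (block a x , block b y)
    co-contig r r∈ spans = block-IsRange a≤x x≤k , block-IsRange b≤y y≤k , r
      , (λ w → spans ∘ to-InBlocks)
      , (λ w → from-InBlocks ∘ InBlocks-closed r∈)
      , (λ w w∈X w∈Y → <⇒≱ (∈ˡ⇒<h w∈X) (∈ʳ⇒≥h w∈Y))
      , (λ u∈ w∈ u≢w → Adj-left u≢w (∈ˡ⇒<h u∈) (∈ˡ⇒<h w∈))
      , (λ u∈ w∈ u≢w → Adj-right u≢w (∈ʳ⇒≥h u∈) (∈ʳ⇒≥h w∈))
      where
      to-InBlocks : ∀ {w} → w ∈ block a x ⊎ w ∈ block b y → InBlocks a x b y w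
      to-InBlocks (inj₁ w∈) = inj₁ (∈block⇒In a≤x x≤k w∈)
      to-InBlocks (inj₂ w∈) = inj₂ (∈block⇒In b≤y y≤k w∈)
      from-InBlocks : ∀ {w} → InBlocks a x b y w → w ∈ block a x ⊎ w ∈ block b y
      from-InBlocks (inj₁ w∈) = inj₁ (In⇒∈block w∈)
      from-InBlocks (inj₂ w∈) = inj₂ (In⇒∈block w∈)

  record NextBlock (a b : ℕ) : Set where
    field
      x y       : ℕ
      a≤x       : a ≤ x
      x≤h       : x ≤ h
      b≤y       : b ≤ y
      y≤k       : y ≤ k
      progress  : a + b < x + y
      co-contig : IsCoContigPair F (block a x , block b y)
      separated : Separated x y

  singletonˡ : ∀ {a b} → a < h → h ≤ b → b ≤ k → Separated a b → (∀ {j} → ¬ CoEdge a j) → NextBlock a b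
  singletonˡ {a} {b} a<h h≤b b≤k sep isolated = record
    { a≤x = n≤1+n a ; x≤h = a<h ; b≤y = ≤-refl ; y≤k = b≤k
    ; progress  = ≤-refl
    ; co-contig = Blocks.co-contig (n≤1+n a) a<h h≤b ≤-refl b≤k sep closed (V a) (inj₁ In-Va) spans
    ; separated = Separated-next (n≤1+n a) ≤-refl sep closed }
    where
    In-Va : In a (suc a) (pos (V a))
    In-Va = subst (In a (suc a)) (sym (pos-V (<-≤-trans a<h h≤k))) (≤-refl , ≤-refl)
    closed : Closed a (suc a) b b
    closed = (λ i∈ _ → subst (λ i → ¬ CoEdge i _) (sym (In-single i∈)) isolated)
           , (λ _ (b≤j , j<b) → ⊥-elim (<⇒≱ j<b b≤j))
    spans : ∀ {w} → InBlocks a (suc a) b b w → CoReach F (V a) w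
    spans {w} (inj₁ w∈) = subst (CoReach F (V a)) (trans (cong V (sym (In-single w∈))) (V-pos w)) here
    spans (inj₂ (b≤w , w<b)) = ⊥-elim (<⇒≱ w<b b≤w)

  singletonʳ : ∀ {a b} → a ≤ h → h ≤ b → b < k → Separated a b → (∀ {i} → ¬ CoEdge i b) → NextBlock a b
  singletonʳ {a} {b} a≤h h≤b b<k sep isolated = record
    { a≤x = ≤-refl ; x≤h = a≤h ; b≤y = n≤1+n b ; y≤k = b<k
    ; progress  = +-monoʳ-< a ≤-refl
    ; co-contig = Blocks.co-contig ≤-refl a≤h h≤b (n≤1+n b) b<k sep closed (V b) (inj₂ In-Vb) spans
    ; separated = Separated-next ≤-refl (n≤1+n b) sep closed }
    where
    In-Vb : In b (suc b) (pos (V b))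
    In-Vb = subst (In b (suc b)) (sym (pos-V b<k)) (≤-refl , ≤-refl)
    closed : Closed a a b (suc b)
    closed = (λ (a≤i , i<a) _ → ⊥-elim (<⇒≱ i<a a≤i))
           , (λ _ j∈ → subst (λ j → ¬ CoEdge _ j) (sym (In-single j∈)) isolated)
    spans : ∀ {w} → InBlocks a a b (suc b) w → CoReach F (V b) w
    spans (inj₁ (a≤w , w<a)) = ⊥-elim (<⇒≱ w<a a≤w)
    spans {w} (inj₂ w∈) = subst (CoReach F (V b)) (trans (cong V (sym (In-single w∈))) (V-pos w)) here

  record Connected (a b x y : ℕ) : Set where
    field
      reachableˡ : ∀ {i} → In a x i → CoReach F (V a) (V i)
      reachableʳ : ∀ {j} → In b y j → CoReach F (V a) (V j)
      partnerˡ   : ∀ {i} → In a x i → ∃ λ j → In b y j × CoEdge i j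
      partnerʳ   : ∀ {j} → In b y j → ∃ λ i → In a x i × CoEdge i j

  CoReach-CoEdge : ∀ {r i j} → CoEdge i j → CoReach F r (V j) → CoReach F r (V i)
  CoReach-CoEdge {i = i} {j} e r↝j = step r↝j (CoEdge⇒≢ e ∘ sym) (CoEdge⇒¬Adj e ∘ Adj-sym {F = F} {V j} {V i})

  CoReach-CoEdge′ : ∀ {r i j} → CoEdge i j → CoReach F r (V i) → CoReach F r (V j)
  CoReach-CoEdge′ e r↝i = step r↝i (CoEdge⇒≢ e) (CoEdge⇒¬Adj e)

  module Growth (a b : ℕ) where

    ExtendsLeft : ℕ → ℕ → Set
    ExtendsLeft x y = ∃ λ j → In b y j × CoEdge x j

    ExtendsRight : ℕ → ℕ → Set
    ExtendsRight x y = ∃ λ i → In a x i × CoEdge i y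

    extendˡ : ∀ {x y} → Connected a b x y → ExtendsLeft x y → Connected a b (suc x) y
    extendˡ {x} {y} conn (j , j∈ , e) = record
      { reachableˡ = λ i∈ → [ reachableˡ , (λ { refl → CoReach-CoEdge e (reachableʳ j∈) }) ]′ (In-suc i∈)
      ; reachableʳ = reachableʳ
      ; partnerˡ   = λ i∈ → [ partnerˡ , (λ { refl → j , j∈ , e }) ]′ (In-suc i∈)
      ; partnerʳ   = λ j∈′ → let i , i∈ , e′ = partnerʳ j∈′ in i , In-widen i∈ , e′ }
      where open Connected conn

    extendʳ : ∀ {x y} → Connected a b x y → ExtendsRight x y → Connected a b x (suc y)
    extendʳ {x} {y} conn (i , i∈ , e) = record
      { reachableˡ = reachableˡ
      ; reachableʳ = λ j∈ → [ reachableʳ , (λ { refl → CoReach-CoEdge′ e (reachableˡ i∈) }) ]′ (In-suc j∈)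
      ; partnerˡ   = λ i∈′ → let j , j∈ , e′ = partnerˡ i∈′ in j , In-widen j∈ , e′
      ; partnerʳ   = λ j∈ → [ partnerʳ , (λ { refl → i , i∈ , e }) ]′ (In-suc j∈) }
      where open Connected conn

    -- A co-edge leaving the block, together with a partner inside it, yields an extension by the staircase property.
    closed : ∀ {x y} → Connected a b x y → ¬ ExtendsLeft x y → ¬ ExtendsRight x y → Closed a x b y
    closed {x} {y} conn ¬left ¬right = out-right , out-left
      where
      open Connected conn
      out-right : NoCoEdge (In a x) (y ≤_)
      out-right i∈ y≤j e with partnerˡ i∈
      ... | j₀ , (_ , j₀<y) , e₀ = ¬right (_ , i∈ , CoEdge-betweenʳ e₀ e (<⇒≤ j₀<y) y≤j)
      out-left : NoCoEdge (x ≤_) (In b y)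
      out-left x≤i j∈ e with partnerʳ j∈
      ... | i₀ , (_ , i₀<x) , e₀ = ¬left (_ , j∈ , CoEdge-betweenˡ e₀ e (<⇒≤ i₀<x) x≤i)

    record Closure (x y : ℕ) : Set where
      field
        x′ y′     : ℕ
        x≤x′      : x ≤ x′
        x′≤h      : x′ ≤ h
        y≤y′      : y ≤ y′
        y′≤k      : y′ ≤ k
        connected : Connected a b x′ y′
        closure   : Closed a x′ b y′

    Closure-sucˡ : ∀ {x y} → Closure (suc x) y → Closure x y
    Closure-sucˡ c = record { x′ = x′ ; y′ = y′ ; x≤x′ = ≤-trans (n≤1+n _) x≤x′ ; x′≤h = x′≤h
                            ; y≤y′ = y≤y′ ; y′≤k = y′≤k ; connected = connected ; closure = closure }
      where open Closure c

    Closure-sucʳ : ∀ {x y} → Closure x (suc y) → Closure x y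
    Closure-sucʳ c = record { x′ = x′ ; y′ = y′ ; x≤x′ = x≤x′ ; x′≤h = x′≤h
                            ; y≤y′ = ≤-trans (n≤1+n _) y≤y′ ; y′≤k = y′≤k
                            ; connected = connected ; closure = closure }
      where open Closure c

    grow : ∀ fuel {x y} → h + k ≤ fuel + (x + y) → x ≤ h → y ≤ k → Connected a b x y → Closure x y
    grow zero {x} {y} fuel≤ x≤h y≤k conn = record
      { x≤x′ = ≤-refl ; x′≤h = x≤h ; y≤y′ = ≤-refl ; y′≤k = y≤k ; connected = conn
      ; closure = closed conn (λ (_ , _ , x<h , _) → <⇒≱ x<h h≤x)
                              (λ (_ , _ , _ , _ , y<k , _) → <⇒≱ y<k k≤y) }
      where
      h≤x = proj₁ (+-≤-tight fuel≤ x≤h y≤k)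
      k≤y = proj₂ (+-≤-tight fuel≤ x≤h y≤k)
    grow (suc n) {x} {y} fuel≤ x≤h y≤k conn with anyIn? (coEdge? x) b y | anyIn? (λ i → coEdge? i y) a x
    ... | yes left@(_ , _ , x<h , _) | _ =
      Closure-sucˡ (grow n (subst (h + k ≤_) (sym (+-suc n (x + y))) fuel≤) x<h y≤k (extendˡ conn left))
    ... | no _ | yes right@(_ , _ , _ , _ , y<k , _) =
      Closure-sucʳ (grow n (subst (h + k ≤_) fuel-eq fuel≤) x≤h y<k (extendʳ conn right))
      where fuel-eq = trans (sym (+-suc n (x + y))) (cong (n +_) (sym (+-suc x y)))
    ... | no ¬left | no ¬right = record
      { x≤x′ = ≤-refl ; x′≤h = x≤h ; y≤y′ = ≤-refl ; y′≤k = y≤k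
      ; connected = conn ; closure = closed conn ¬left ¬right }

  grown-block : ∀ {a b} → Separated a b → CoEdge a b → NextBlock a b
  grown-block {a} {b} sep e@(a<h , h≤b , b<k , _) = record
    { a≤x = a≤x′ ; x≤h = x′≤h ; b≤y = b≤y′ ; y≤k = y′≤k
    ; progress  = +-mono-< x≤x′ y≤y′
    ; co-contig = Blocks.co-contig a≤x′ x′≤h h≤b b≤y′ y′≤k sep closure (V a) (inj₁ In-Va) spans
    ; separated = Separated-next a≤x′ b≤y′ sep closure }
    where
    open Growth a b
    start : Connected a b (suc a) (suc b)
    start = record
      { reachableˡ = λ i∈ → subst (λ i → CoReach F (V a) (V i)) (sym (In-single i∈)) here
      ; reachableʳ = λ j∈ → subst (λ j → CoReach F (V a) (V j)) (sym (In-single j∈)) (CoReach-CoEdge′ e here)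
      ; partnerˡ   = λ i∈ → b , (≤-refl , ≤-refl) , subst (λ i → CoEdge i b) (sym (In-single i∈)) e
      ; partnerʳ   = λ j∈ → a , (≤-refl , ≤-refl) , subst (CoEdge a) (sym (In-single j∈)) e }
    open Closure (grow (h + k) (m≤m+n (h + k) _) a<h b<k start)
    open Connected connected
    a≤x′ = <⇒≤ x≤x′
    b≤y′ = <⇒≤ y≤y′
    In-Va : In a x′ (pos (V a))
    In-Va = subst (In a x′) (sym (pos-V (<-≤-trans a<h h≤k))) (≤-refl , x≤x′)
    spans : ∀ {w} → InBlocks a x′ b y′ w → CoReach F (V a) w
    spans {w} (inj₁ w∈) = subst (CoReach F (V a)) (V-pos w) (reachableˡ w∈)
    spans {w} (inj₂ w∈) = subst (CoReach F (V a)) (V-pos w) (reachableʳ w∈)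

  next-block : ∀ {a b} → a ≤ h → h ≤ b → b ≤ k → a < h ⊎ b < k → Separated a b → NextBlock a b
  next-block {a} {b} a≤h h≤b b≤k unfinished sep with a <? h
  ... | no a≮h = singletonʳ a≤h h≤b b<k sep isolated
    where
    b<k = [ (λ a<h → ⊥-elim (a≮h a<h)) , (λ b<k → b<k) ]′ unfinished
    isolated : ∀ {i} → ¬ CoEdge i b
    isolated e@(i<h , _) = proj₁ sep (<-≤-trans i<h (≮⇒≥ a≮h)) ≤-refl e
  ... | yes a<h with anyUpTo? (coEdge? a) k
  ...   | no ¬eʲ = singletonˡ a<h h≤b b≤k sep (λ {j} e@(_ , _ , j<k , _) → ¬eʲ (j , j<k , e))
  ...   | yes (j , _ , eʲ@(_ , _ , j<k , _)) with anyUpTo? (λ i → coEdge? i b) h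
  ...     | no ¬eᵢ = singletonʳ a≤h h≤b (≤-<-trans b≤j j<k) sep (λ {i} e@(i<h , _) → ¬eᵢ (i , i<h , e))
    where b≤j = ≮⇒≥ (λ j<b → proj₂ sep ≤-refl j<b eʲ)
  ...     | yes (i , _ , eᵢ) = grown-block sep (CoEdge-corner a≤i b≤j eʲ eᵢ)
    where
    a≤i = ≮⇒≥ (λ i<a → proj₁ sep i<a ≤-refl eᵢ)
    b≤j = ≮⇒≥ (λ j<b → proj₂ sep ≤-refl j<b eʲ)

  record Tail (a b : ℕ) : Set where
    field
      pairs        : List (List (Fin k) × List (Fin k))
      all-co-contig : All (IsCoContigPair F) pairs
      firsts       : concat (map proj₁ pairs) ≡ block a h
      seconds      : concat (map proj₂ pairs) ≡ block b k

  Tail-empty : ∀ {a b} → h ≤ a → k ≤ b → Tail a b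
  Tail-empty h≤a k≤b = record
    { pairs = [] ; all-co-contig = All.[]
    ; firsts = cong (seg _) (sym (m≤n⇒m∸n≡0 h≤a)) ; seconds = cong (seg _) (sym (m≤n⇒m∸n≡0 k≤b)) }

  Tail-prepend : ∀ {a b} → (nb : NextBlock a b) → Tail (NextBlock.x nb) (NextBlock.y nb) → Tail a b
  Tail-prepend {a} {b} nb t = record
    { pairs = (block a x , block b y) ∷ pairs
    ; all-co-contig = co-contig All.∷ all-co-contig
    ; firsts = trans (cong (block a x ++_) firsts) (sym (block-++ a≤x x≤h))
    ; seconds = trans (cong (block b y ++_) seconds) (sym (block-++ b≤y y≤k)) }
    where
    open NextBlock nb
    open Tail t

  build : ∀ fuel {a b} → h + k ≤ fuel + (a + b) → a ≤ h → h ≤ b → b ≤ k → Separated a b → Tail a b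
  build zero fuel≤ a≤h _ b≤k _ = let h≤a , k≤b = +-≤-tight fuel≤ a≤h b≤k in Tail-empty h≤a k≤b
  build (suc n) {a} {b} fuel≤ a≤h h≤b b≤k sep with (a <? h) ⊎-dec (b <? k)
  ... | no finished = Tail-empty (≮⇒≥ (finished ∘ inj₁)) (≮⇒≥ (finished ∘ inj₂))
  ... | yes unfinished = Tail-prepend nb (build n fuel≤′ x≤h (≤-trans h≤b b≤y) y≤k separated)
    where
    nb = next-block a≤h h≤b b≤k unfinished sep
    open NextBlock nb
    fuel≤′ : h + k ≤ n + (x + y)
    fuel≤′ = ≤-trans fuel≤ (subst (_≤ n + (x + y)) (+-suc n (a + b)) (+-monoʳ-≤ n progress))

  frame-pairs : ∃ λ ps → All (IsCoContigPair F) ps × concat (map proj₁ ps) ++ concat (map proj₂ ps) ≡ seg o k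
  frame-pairs = pairs , all-co-contig , trans (cong₂ _++_ firsts seconds) (sym (block-++ z≤n h≤k))
    where
    separated : Separated 0 h
    separated = (λ ()) , λ _ j<h (_ , h≤j , _) → <⇒≱ j<h h≤j
    open Tail (build (h + k) (m≤m+n (h + k) _) z≤n ≤-refl h≤k separated)

module _ {k} (F : Fin k → Fin k) where

  NonAdj : Fin k → Fin k → Set
  NonAdj x w = x ≢ w × ¬ Adj F x w

  adj? : ∀ u w → Dec (Adj F u w)
  adj? u w = arrow? u w ⊎-dec arrow? w u
    where arrow? = λ b w → (0 <? off b w) ×-dec (off b w ≤? reach F b)

  complete⊎NonAdj : (∀ {u w} → u ≢ w → Adj F u w) ⊎ ∃ λ u → ∃ λ w → NonAdj u w
  complete⊎NonAdj with any? (λ u → any? (λ w → ¬? (u Fin.≟ w) ×-dec ¬? (adj? u w)))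
  ... | yes non-adjacent = inj₂ non-adjacent
  ... | no ¬non-adjacent = inj₁ complete
    where
    complete : ∀ {u w} → u ≢ w → Adj F u w
    complete {u} {w} u≢w with adj? u w
    ... | yes adj = adj
    ... | no ¬adj = ⊥-elim (¬non-adjacent (u , w , u≢w , ¬adj))

module _ {k} {F : Fin k → Fin k} (R : IsRoundRep F) where

  frame⇒natural-ordering : ∀ (o : Fin k) h → h ≤ k →
    (∀ {i j} → i < j → j < h → Adj F (next^ i o) (next^ j o)) →
    (∀ {i j} → h ≤ i → i < j → j < k → Adj F (next^ i o) (next^ j o)) →
    ∃ λ ps → NaturalOrdering F ps
  frame⇒natural-ordering o h h≤k cliqueˡ cliqueʳ with Frame.frame-pairs R o h h≤k cliqueˡ cliqueʳ
  ... | ps , all-co-contig , concat≡ = ps , natural-ordering all-co-contig (toℕ o , trans concat≡ (seg-rotation o))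

  complete⇒natural-ordering : (o : Fin k) → (∀ {u w} → u ≢ w → Adj F u w) → ∃ λ ps → NaturalOrdering F ps
  complete⇒natural-ordering o complete = frame⇒natural-ordering o k ≤-refl
    (λ i<j j<k → complete (Positions.V-injective F o i<j j<k))
    (λ k≤i i<j j<k → ⊥-elim (<⇒≱ (<-trans i<j j<k) k≤i))

  beyond : Fin k → Fin k
  beyond z = next^ (suc (reach F z)) z

  -- The arcs of z and of beyond z cover ℬ, so that [z, F z] and [beyond z, z) are cliques.
  CliqueSplit : Fin k → Set
  CliqueSplit z = suc (reach F z) < k × k ≤ suc (reach F z) + suc (reach F (beyond z))

  cliqueSplit? : ∀ z → Dec (CliqueSplit z)
  cliqueSplit? z = suc (reach F z) <? k ×-dec k ≤? suc (reach F z) + suc (reach F (beyond z))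

  CliqueSplit⇒natural-ordering : ∀ z → CliqueSplit z → ∃ λ ps → NaturalOrdering F ps
  CliqueSplit⇒natural-ordering z (h<k , covered) = frame⇒natural-ordering z h (<⇒≤ h<k) cliqueˡ cliqueʳ
    where
    open Positions F z
    h = suc (reach F z)
    cliqueˡ : ∀ {i j} → i < j → j < h → Adj F (V i) (V j)
    cliqueˡ {i} i<j j<h = inj₁ (Arrow-forward⇐ i<j (<-trans j<h h<k) (≤-trans (s≤s⁻¹ j<h) (+reach-mono R z (z≤n {i}))))
    cliqueʳ : ∀ {i j} → h ≤ i → i < j → j < k → Adj F (V i) (V j)
    cliqueʳ h≤i i<j j<k = inj₁ (Arrow-forward⇐ i<j j<k (≤-trans j≤h+reach (+reach-mono R z h≤i)))
      where j≤h+reach = s≤s⁻¹ (<-≤-trans j<k (subst (k ≤_) (+-suc h _) covered))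

  NonAdj⇒short : ∀ {x w} → NonAdj F x w → suc (reach F x) < k
  NonAdj⇒short {x} {w} (x≢w , ¬adj) with suc (reach F x) <? k
  ... | yes short = short
  ... | no ¬short = ⊥-elim (¬adj (inj₁ (off>0 x w x≢w , s≤s⁻¹ (<-≤-trans (off< x w) (≮⇒≥ ¬short)))))

  misses-beyond : ∀ x → 1 < k → suc (reach F (next x)) + suc (reach F (beyond (next x))) < k →
    NonAdj F x (beyond (next x)) × NonAdj F (next x) (beyond (next x))
  misses-beyond x 1<k short = (V-injective 0<p p<k , Apart⇒¬Adj 0<p p<k (s≤s (reach-next R x) , short′))
                            , (V-injective 1<p p<k , Apart⇒¬Adj 1<p p<k (≤-refl , <-trans short′ (n<1+n k)))
    where
    open Positions F x
    p = suc (suc (reach F (next x)))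
    short′ : p + reach F (V p) < k
    short′ = subst (_< k) (+-suc (suc (reach F (next x))) _) short
    p<k : p < k
    p<k = ≤-<-trans (m≤m+n p _) short′
    0<p : 0 < p
    0<p = s≤s z≤n
    1<p : 1 < p
    1<p = s≤s (s≤s z≤n)

  module Splitting (c : Fin k → Bool) (classes : ∀ a b → c a ≡ c b → a ≢ b → Adj F a b) where

    same-colour : ∀ {x y w} → NonAdj F x w → NonAdj F y w → c x ≡ c y
    same-colour (x≢w , ¬adjˣ) (y≢w , ¬adjʸ) =
      trans (¬-not (λ eq → ¬adjˣ (classes _ _ eq x≢w))) (sym (¬-not (λ eq → ¬adjʸ (classes _ _ eq y≢w))))

    Unsplit : Fin k → Fin k → Set
    Unsplit u x = suc (reach F x) < k × ¬ CliqueSplit x × c x ≡ c u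

    settle : ∀ {u} x → suc (reach F x) < k → c x ≡ c u → (∃ CliqueSplit) ⊎ Unsplit u x
    settle x short same with cliqueSplit? x
    ... | yes split = inj₁ (x , split)
    ... | no ¬split = inj₂ (short , ¬split , same)

    -- Walking backwards from u, each unsplit semiblock passes its colour on to its predecessor.
    towards : ∀ {u v} → NonAdj F u v → ∀ d x → off x u ≡ d → (∃ CliqueSplit) ⊎ Unsplit u x
    towards {u} uv zero x e =
      subst (λ y → (∃ CliqueSplit) ⊎ Unsplit u y) (sym (off≡0⇒≡ x u e)) (settle u (NonAdj⇒short uv) refl)
    towards {u} uv (suc d) x e with towards uv d (next x) (off-next-pred x u e)
    ... | inj₁ split = inj₁ split
    ... | inj₂ (short , ¬split , same) = settle x (NonAdj⇒short missˣ) (trans (same-colour missˣ missʸ) same)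
      where
      1<k = ≤-<-trans (s≤s z≤n) (subst (_< k) e (off< x u))
      misses = misses-beyond x 1<k (≰⇒> (λ k≤ → ¬split (short , k≤)))
      missˣ = proj₁ misses
      missʸ = proj₂ misses

    split-exists : ∀ {u v} → NonAdj F u v → ∃ CliqueSplit
    split-exists {u} {v} uv@(u≢v , ¬adj) with towards uv (off v u) v refl
    ... | inj₁ split = split
    ... | inj₂ (_ , _ , same) = ⊥-elim (¬adj (Adj-sym {F = F} {v} {u} (classes v u same (u≢v ∘ sym))))

lemma21 : (k : ℕ) (F : Fin k → Fin k) → IsRoundRep F → IsNormal F → CoBipartite F
    → ∃ λ (ps : List (List (Fin k) × List (Fin k))) → NaturalOrdering F ps
lemma21 zero    F R _ _ = [] , natural-ordering All.[] (0 , refl)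
lemma21 (suc k) F R _ (c , classes) with complete⊎NonAdj F
... | inj₁ complete = complete⇒natural-ordering R Fin.zero complete
... | inj₂ (_ , _ , uv) =
  let z , split = Splitting.split-exists R c classes uv in CliqueSplit⇒natural-ordering R z split
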